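{- Let $q$ be a prime power, $n>1$, $F$ an algebraically closed field of characteristic dividing $q$, and $\mathbf{G}=\operatorname{SL}_{n+1}(F)$. Let $\varepsilon_u$ ($1\le u\le n+1$) be the character of the diagonal torus taking a diagonal matrix to its $u$-th entry; the fundamental weights are $\omega_i=\varepsilon_1+\cdots+\varepsilon_i$, and the Weyl group $W\cong S_{n+1}$ acts on weights by permuting the $\varepsilon_u$. Let $\pi=[n_1\ge\cdots\ge n_k]$ be a partition of $n+1$ and let $D_\pi$ be the group of diagonal matrices of determinant $1$ of the form $\mathop{\rm diag}(y_1,y_1^q,\dots,y_1^{q^{n_1-1}},\dots,y_k,y_k^q,\dots,y_k^{q^{n_k-1}})$ with $y_j\in\mathbb{F}_{q^{n_j}}^\times$. Fix $i\in\{1,\dots,n\}$ and set $\kappa_i=(q-1)\omega_i+\omega_1+\omega_n$ and $\lambda_i=(q-1)\omega_i$. Then there is a weight $\mu\in W\kappa_i\cup W\lambda_i$ such that $\mu|_{D_\pi}=1_{D_\pi}$.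
   Context: Here $D_\pi$ is the standard diagonal model of the maximal torus $T_\pi$ of $\operatorname{SL}_{n+1}(q)$ labelled by $\pi$; a weight $\mu=\sum a_u\varepsilon_u$ is evaluated on a diagonal matrix $\mathop{\rm diag}(x_1,\dots,x_{n+1})$ as $\prod x_u^{a_u}$. -}

module Defs where

open import Level using (Level; _⊔_)
open import Data.Nat as ℕ using (ℕ; zero; suc; _≤_; _<_; _∸_; _≥_)
open import Data.Nat.Primality using (Prime)
open import Data.Fin using (Fin; toℕ)
open import Data.List using (List; []; _∷_; length; foldr; map; upTo; concatMap; allFin; zipWith; lookup; tabulate)
open import Data.Nat.ListAction using (sum)
open import Data.List.Relation.Unary.All using (All)
open import Data.Product using (Σ; ∃; _×_; _,_)
open import Data.Sum using (_⊎_)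
open import Relation.Nullary using (¬_)
open import Relation.Binary.PropositionalEquality using (_≡_)
open import Algebra.Bundles using (CommutativeRing)
open import Data.Fin.Permutation using (Permutation′; _⟨$⟩ʳ_)

IsPrimePowerOf : ℕ → ℕ → Set
IsPrimePowerOf p q = Prime p × Σ ℕ (λ e → (1 ≤ e) × (q ≡ p ℕ.^ e))

module RingOps {c ℓ : Level} (R : CommutativeRing c ℓ) where
  open CommutativeRing R

  pow : Carrier → ℕ → Carrier
  pow x zero = 1#
  pow x (suc m) = x * pow x m

  prod : List Carrier → Carrier
  prod = foldr _*_ 1#

  natR : ℕ → Carrier
  natR zero = 0#
  natR (suc m) = 1# + natR m

  horner : List Carrier → Carrier → Carrier
  horner [] x = 0#
  horner (a ∷ as) x = a + x * horner as x

  evalMonic : List Carrier → Carrier → Carrier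
  evalMonic cs x = pow x (length cs) + horner cs x

IsField : {c ℓ : Level} → CommutativeRing c ℓ → Set (c ⊔ ℓ)
IsField R = ¬ (1# ≈ 0#) × (∀ x → ¬ (x ≈ 0#) → Σ Carrier λ y → x * y ≈ 1#)
  where open CommutativeRing R

IsAlgClosed : {c ℓ : Level} → CommutativeRing c ℓ → Set (c ⊔ ℓ)
IsAlgClosed R = ∀ (cs : List Carrier) → 1 ≤ length cs → Σ Carrier λ x → evalMonic cs x ≈ 0#
  where open CommutativeRing R
        open RingOps R

HasChar : {c ℓ : Level} → CommutativeRing c ℓ → ℕ → Set ℓ
HasChar R p = natR p ≈ 0#
  where open CommutativeRing R
        open RingOps R

data Nonincreasing : List ℕ → Set where
  ni-[]  : Nonincreasing []
  ni-[x] : ∀ {x} → Nonincreasing (x ∷ [])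
  ni-∷   : ∀ {x y ys} → y ≤ x → Nonincreasing (y ∷ ys) → Nonincreasing (x ∷ y ∷ ys)

IsPartition : ℕ → List ℕ → Set
IsPartition N π = All (λ m → 1 ≤ m) π × Nonincreasing π × sum π ≡ N

-- weights of the diagonal torus of SL_{n+1}: a = (a_1,…,a_{n+1}) ↦ Σ a_u ε_u
-- (all weights used here have nonnegative coefficients)
Weight : ℕ → Set
Weight n = Fin (suc n) → ℕ

ω : (n i : ℕ) → Weight n
ω n i u with toℕ u ℕ.<? i
... | Relation.Nullary.yes _ = 1
... | Relation.Nullary.no _ = 0

κ : (q n i : ℕ) → Weight n
κ q n i u = (q ∸ 1) ℕ.* ω n i u ℕ.+ ω n 1 u ℕ.+ ω n n u

λw : (q n i : ℕ) → Weight n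
λw q n i u = (q ∸ 1) ℕ.* ω n i u

-- Weyl group action: σ permutes the ε_u, (σ·μ)(ε_{σ(u)}) = μ(ε_u)
act : {n : ℕ} → Permutation′ (suc n) → Weight n → Weight n
act σ μ u = μ (Data.Fin.Permutation._⟨$⟩ˡ_ σ u)

module TorusOps {c ℓ : Level} (R : CommutativeRing c ℓ) (q : ℕ) (π : List ℕ) where
  open CommutativeRing R
  open RingOps R

  diagEntries : (Fin (length π) → Carrier) → List Carrier
  diagEntries y = concatMap (λ j → map (λ t → pow (y j) (q ℕ.^ t)) (upTo (lookup π j))) (allFin (length π))

  -- y parametrises an element of D_π: y_j ∈ F_{q^{n_j}}^× and determinant 1
  InDπ : (Fin (length π) → Carrier) → Set ℓ
  InDπ y = (∀ j → ¬ (y j ≈ 0#)) × (∀ j → pow (y j) (q ℕ.^ lookup π j) ≈ y j) × (prod (diagEntries y) ≈ 1#)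

  evalWeight : {n : ℕ} → Weight n → List Carrier → Carrier
  evalWeight {n} μ xs = prod (zipWith pow xs (tabulate μ))

  TrivialOnDπ : {n : ℕ} → Weight n → Set (c ⊔ ℓ)
  TrivialOnDπ μ = ∀ (y : Fin (length π) → Carrier) → InDπ y → evalWeight μ (diagEntries y) ≈ 1#

-- An element of D_π is a list of blocks (y, y ^ q, …, y ^ q ^ (m - 1)) with y ^ q ^ m = y, and a
-- weight with coefficients c_v evaluates on the block starting at position o to y raised to the
-- q-adic number c_o + c_{o+1} q + ⋯ + c_{o+m-1} q ^ (m - 1).  Since y ^ ((q - 1)(1 + q + ⋯ + q ^ (m - 1)))
-- = y ^ (q ^ m - 1) = 1, adding q - 1 to every coefficient of a block does not change its value.
-- If i = n₁ + ⋯ + n_s ends a block, λ_i is q - 1 on the first s blocks and 0 afterwards, so it is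
-- trivial.  Otherwise i lies strictly inside a block starting at P.  Swapping the positions 0 ↔ P and
-- i ↔ n turns κ_i into q, …, q before P, into q + 1, q, …, q, 0, 1, …, 1 on that block, whose q-adic
-- value is 1 + q + ⋯ + q ^ (m - 1) after carrying, and into 1 afterwards; so on D_π it agrees with
-- ε₁ + ⋯ + ε_{n+1}, i.e. with the determinant.

{-# OPTIONS --safe #-}
module Submission where

open import Defs
open import Level using (Level)
open import Data.Nat using (ℕ; suc; _≤_; _<_)
open import Data.List using (List)
open import Data.Product using (Σ; _×_)
open import Data.Sum using (_⊎_)
open import Algebra.Bundles using (CommutativeRing)
open import Data.Fin.Permutation using (Permutation′)

module Expansion where
  open import Data.Nat
  open import Data.Nat.Properties
  open import Data.Nat.Solver using (module +-*-Solver)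
  open +-*-Solver
  open import Function using (_∘_)
  open import Relation.Binary.PropositionalEquality
  open import Relation.Nullary using (contradiction)
  open ≡-Reasoning

  expansion : ℕ → ℕ → (ℕ → ℕ) → ℕ
  expansion q zero    f = 0
  expansion q (suc m) f = f 0 + q * expansion q m (f ∘ suc)

  repunit : ℕ → ℕ → ℕ
  repunit q m = expansion q m (λ _ → 1)

  module _ (q : ℕ) where

    expansion-cong : ∀ m {f g} → (∀ t → t < m → f t ≡ g t) → expansion q m f ≡ expansion q m g
    expansion-cong zero    f≡g = refl
    expansion-cong (suc m) f≡g =
      cong₂ (λ a e → a + q * e) (f≡g 0 z<s) (expansion-cong m (λ t t<m → f≡g (suc t) (s<s t<m)))

    expansion-+ : ∀ m f g → expansion q m (λ t → f t + g t) ≡ expansion q m f + expansion q m g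
    expansion-+ zero    f g = refl
    expansion-+ (suc m) f g = begin
      f 0 + g 0 + q * expansion q m (λ t → f (suc t) + g (suc t))
        ≡⟨ cong (λ e → f 0 + g 0 + q * e) (expansion-+ m (f ∘ suc) (g ∘ suc)) ⟩
      f 0 + g 0 + q * (expansion q m (f ∘ suc) + expansion q m (g ∘ suc))
        ≡⟨ solve 5 (λ a b q x y → a :+ b :+ q :* (x :+ y) := a :+ q :* x :+ (b :+ q :* y)) refl (f 0) (g 0) q _ _ ⟩
      expansion q (suc m) f + expansion q (suc m) g ∎

    expansion-const : ∀ m a → expansion q m (λ _ → a) ≡ a * repunit q m
    expansion-const zero    a = sym (*-zeroʳ a)
    expansion-const (suc m) a = begin
      a + q * expansion q m (λ _ → a) ≡⟨ cong (λ e → a + q * e) (expansion-const m a) ⟩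
      a + q * (a * repunit q m)       ≡⟨ solve 3 (λ a q r → a :+ q :* (a :* r) := a :* (con 1 :+ q :* r)) refl a q (repunit q m) ⟩
      a * repunit q (suc m)           ∎

    expansion-carry : ∀ r m f → r < m → (∀ t → t < r → f t ≡ q) → f r ≡ 0 →
      (∀ t → r < t → t < m → f t ≡ 1) → expansion q m f + 1 ≡ repunit q m
    expansion-carry zero (suc m) f _ _ f0≡0 ones = begin
      f 0 + q * expansion q m (f ∘ suc) + 1
        ≡⟨ cong₂ (λ a e → a + q * e + 1) f0≡0 (expansion-cong m (λ t t<m → ones (suc t) z<s (s<s t<m))) ⟩
      q * repunit q m + 1 ≡⟨ +-comm _ 1 ⟩
      repunit q (suc m)   ∎
    expansion-carry (suc r) (suc m) f (s<s r<m) qs fr≡0 ones = begin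
      f 0 + q * E + 1   ≡⟨ cong (λ a → a + q * E + 1) (qs 0 z<s) ⟩
      q + q * E + 1     ≡⟨ solve 2 (λ q e → q :+ q :* e :+ con 1 := con 1 :+ q :* (e :+ con 1)) refl q E ⟩
      1 + q * (E + 1)   ≡⟨ cong (λ e → 1 + q * e) (expansion-carry r m (f ∘ suc) r<m
                             (λ t t<r → qs (suc t) (s<s t<r)) fr≡0 (λ t r<t t<m → ones (suc t) (s<s r<t) (s<s t<m))) ⟩
      repunit q (suc m) ∎
      where E = expansion q m (f ∘ suc)

    expansion-borrow : ∀ r m f → r < m → f 0 ≡ suc q → (∀ t → 0 < t → t < r → f t ≡ q) → f r ≡ 0 →
      (∀ t → r < t → t < m → f t ≡ 1) → expansion q m f ≡ repunit q m
    expansion-borrow zero    m       f _         f0≡1+q _  f0≡0 _    = contradiction (trans (sym f0≡1+q) f0≡0) 1+n≢0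
    expansion-borrow (suc r) (suc m) f (s<s r<m) f0≡1+q qs fr≡0 ones = begin
      f 0 + q * E       ≡⟨ cong (_+ q * E) f0≡1+q ⟩
      suc q + q * E     ≡⟨ solve 2 (λ q e → con 1 :+ q :+ q :* e := con 1 :+ q :* (e :+ con 1)) refl q E ⟩
      1 + q * (E + 1)   ≡⟨ cong (λ e → 1 + q * e) (expansion-carry r m (f ∘ suc) r<m
                             (λ t t<r → qs (suc t) z<s (s<s t<r)) fr≡0 (λ t r<t t<m → ones (suc t) (s<s r<t) (s<s t<m))) ⟩
      repunit q (suc m) ∎
      where E = expansion q m (f ∘ suc)

  pred*repunit+1≡^ : ∀ q′ m → q′ * repunit (suc q′) m + 1 ≡ suc q′ ^ m
  pred*repunit+1≡^ q′ zero    = cong (_+ 1) (*-zeroʳ q′)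
  pred*repunit+1≡^ q′ (suc m) = begin
    q′ * (1 + suc q′ * R) + 1
      ≡⟨ solve 2 (λ x r → x :* (con 1 :+ (con 1 :+ x) :* r) :+ con 1 := (con 1 :+ x) :* (x :* r :+ con 1)) refl q′ R ⟩
    suc q′ * (q′ * R + 1)      ≡⟨ cong (suc q′ *_) (pred*repunit+1≡^ q′ m) ⟩
    suc q′ ^ suc m             ∎
    where R = repunit (suc q′) m

module Lists where
  open import Data.Nat
  open import Data.Nat.ListAction using (sum)
  open import Data.Nat.Properties
  open import Data.List using (List; []; _∷_; _++_; map)
  open import Data.List.Properties using (∷-injectiveˡ; ∷-injectiveʳ)
  open import Data.Product using (∃-syntax; _×_; _,_)
  open import Relation.Binary.PropositionalEquality
  open import Relation.Nullary using (yes; no; contradiction)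

  split-containing : ∀ ms o i → o ≤ i → i < o + sum ms →
    ∃[ as ] ∃[ m ] ∃[ bs ] ms ≡ as ++ m ∷ bs × o + sum as ≤ i × i < o + sum as + m
  split-containing []       o i o≤i i<o+0 = contradiction (subst (i <_) (+-identityʳ o) i<o+0) (≤⇒≯ o≤i)
  split-containing (m ∷ ms) o i o≤i i<o+Σ with i <? o + m
  ... | yes i<o+m =
    [] , m , ms , refl , subst (_≤ i) (sym (+-identityʳ o)) o≤i , subst (λ x → i < x + m) (sym (+-identityʳ o)) i<o+m
  ... | no i≮o+m with split-containing ms (o + m) i (≮⇒≥ i≮o+m) (subst (i <_) (sym (+-assoc o m (sum ms))) i<o+Σ)
  ...   | as , m′ , bs , ms≡ , lo , hi =
    m ∷ as , m′ , bs , cong (m ∷_) ms≡ ,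
    subst (_≤ i) (+-assoc o m (sum as)) lo , subst (λ x → i < x + m′) (+-assoc o m (sum as)) hi

  map-≡-++ : ∀ {a b} {A : Set a} {B : Set b} (f : A → B) xs {as bs} → map f xs ≡ as ++ bs →
    ∃[ ys ] ∃[ zs ] xs ≡ ys ++ zs × map f ys ≡ as × map f zs ≡ bs
  map-≡-++ f xs       {[]}     eq = [] , xs , refl , refl , eq
  map-≡-++ f (x ∷ xs) {a ∷ as} eq with map-≡-++ f xs (∷-injectiveʳ eq)
  ... | ys , zs , refl , ys≡ , zs≡ = x ∷ ys , zs , refl , cong₂ _∷_ (∷-injectiveˡ eq) ys≡ , zs≡

module KappaCoefficients where
  open import Data.Nat
  open import Data.Nat.Properties
  open import Data.Nat.Solver using (module +-*-Solver)
  open +-*-Solver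
  open import Data.Fin as Fin using (Fin; toℕ; fromℕ; fromℕ<)
  open import Data.Fin.Properties using (toℕ-injective; toℕ-fromℕ; toℕ-fromℕ<)
  open import Data.Fin.Permutation using (Permutation′; transpose; _∘ₚ_; _⟨$⟩ˡ_)
  import Data.Fin.Permutation.Components as PC
  open import Data.Product using (_×_; _,_)
  open import Relation.Nullary using (Dec; yes; no; ¬_; contradiction)
  open import Relation.Binary.PropositionalEquality
  open Expansion

  𝟙 : ∀ {a} {A : Set a} → Dec A → ℕ
  𝟙 (yes _) = 1
  𝟙 (no _)  = 0

  𝟙-yes : ∀ {a} {A : Set a} (d : Dec A) → A → 𝟙 d ≡ 1
  𝟙-yes (yes _) _ = refl
  𝟙-yes (no ¬a) a = contradiction a ¬a

  𝟙-no : ∀ {a} {A : Set a} (d : Dec A) → ¬ A → 𝟙 d ≡ 0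
  𝟙-no (yes a) ¬a = contradiction a ¬a
  𝟙-no (no _)  _  = refl

  ω≡𝟙 : ∀ n i u → ω n i u ≡ 𝟙 (toℕ u <? i)
  ω≡𝟙 n i u with toℕ u <? i
  ... | yes _ = refl
  ... | no _  = refl

  transposeℕ : ℕ → ℕ → ℕ → ℕ
  transposeℕ a b v with v ≟ a
  ... | yes _ = b
  ... | no _ with v ≟ b
  ...   | yes _ = a
  ...   | no _  = v

  transposeℕ-ˡ : ∀ a b → transposeℕ a b a ≡ b
  transposeℕ-ˡ a b with a ≟ a
  ... | yes _   = refl
  ... | no a≢a  = contradiction refl a≢a

  transposeℕ-ʳ : ∀ a b → transposeℕ a b b ≡ a
  transposeℕ-ʳ a b with b ≟ a
  ... | yes b≡a = b≡a
  ... | no _ with b ≟ b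
  ...   | yes _  = refl
  ...   | no b≢b = contradiction refl b≢b

  transposeℕ-≢ : ∀ {a b v} → v ≢ a → v ≢ b → transposeℕ a b v ≡ v
  transposeℕ-≢ {a} {b} {v} v≢a v≢b with v ≟ a
  ... | yes v≡a = contradiction v≡a v≢a
  ... | no _ with v ≟ b
  ...   | yes v≡b = contradiction v≡b v≢b
  ...   | no _    = refl

  toℕ-transpose : ∀ {n} (a b k : Fin n) → toℕ (PC.transpose a b k) ≡ transposeℕ (toℕ a) (toℕ b) (toℕ k)
  toℕ-transpose a b k with k Fin.≟ a | toℕ k ≟ toℕ a
  ... | yes _   | yes _   = refl
  ... | yes k≡a | no k≢a  = contradiction (cong toℕ k≡a) k≢a
  ... | no k≢a  | yes k≡a = contradiction (toℕ-injective k≡a) k≢a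
  ... | no _    | no _ with k Fin.≟ b | toℕ k ≟ toℕ b
  ...   | yes _   | yes _   = refl
  ...   | yes k≡b | no k≢b  = contradiction (cong toℕ k≡b) k≢b
  ...   | no k≢b  | yes k≡b = contradiction (toℕ-injective k≡b) k≢b
  ...   | no _    | no _    = refl

  -- the coefficient of ε_{v+1} in κ_i for q = suc q′: positions are counted from 0
  κ-coeff : ℕ → ℕ → ℕ → ℕ → ℕ
  κ-coeff q′ n i v = q′ * 𝟙 (v <? i) + 𝟙 (v <? 1) + 𝟙 (v <? n)

  κ≡κ-coeff : ∀ q′ n i u → κ (suc q′) n i u ≡ κ-coeff q′ n i (toℕ u)
  κ≡κ-coeff q′ n i u rewrite ω≡𝟙 n i u | ω≡𝟙 n 1 u | ω≡𝟙 n n u = refl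

  module _ (q′ : ℕ) {n i : ℕ} (1≤i : 1 ≤ i) (i≤n : i ≤ n) (1<n : 1 < n) where

    κ-coeff-0 : κ-coeff q′ n i 0 ≡ suc (suc q′)
    κ-coeff-0 rewrite 𝟙-yes (0 <? i) 1≤i | 𝟙-yes (0 <? n) (<-trans z<s 1<n) =
      solve 1 (λ x → x :* con 1 :+ con 1 :+ con 1 := con 2 :+ x) refl q′

    κ-coeff-low : ∀ {v} → 0 < v → v < i → κ-coeff q′ n i v ≡ suc q′
    κ-coeff-low {v} 0<v v<i
      rewrite 𝟙-yes (v <? i) v<i | 𝟙-no (v <? 1) (≤⇒≯ 0<v) | 𝟙-yes (v <? n) (<-≤-trans v<i i≤n) =
      solve 1 (λ x → x :* con 1 :+ con 0 :+ con 1 := con 1 :+ x) refl q′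

    κ-coeff-n : κ-coeff q′ n i n ≡ 0
    κ-coeff-n rewrite 𝟙-no (n <? i) (≤⇒≯ i≤n) | 𝟙-no (n <? 1) (≤⇒≯ (<⇒≤ 1<n)) | 𝟙-no (n <? n) (<-irrefl refl) =
      cong (λ x → x + 0 + 0) (*-zeroʳ q′)

    κ-coeff-high : ∀ {v} → i ≤ v → v < n → κ-coeff q′ n i v ≡ 1
    κ-coeff-high {v} i≤v v<n
      rewrite 𝟙-no (v <? i) (≤⇒≯ i≤v) | 𝟙-no (v <? 1) (≤⇒≯ (≤-trans 1≤i i≤v)) | 𝟙-yes (v <? n) v<n =
      cong (λ x → x + 0 + 1) (*-zeroʳ q′)

  module PermutedKappa (q′ : ℕ) {n i P : ℕ} (1≤i : 1 ≤ i) (i≤n : i ≤ n) (1<n : 1 < n) (P<i : P < i) where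

    private
      P<n : P < n
      P<n = <-≤-trans P<i i≤n

    -- position P receives the coefficient q + 1 of position 0, and position i the coefficient 0 of position n
    κ-permutation : Permutation′ (suc n)
    κ-permutation = transpose Fin.zero (fromℕ< (s≤s (<⇒≤ P<n))) ∘ₚ transpose (fromℕ< (s≤s i≤n)) (fromℕ n)

    τ : ℕ → ℕ
    τ v = transposeℕ P 0 (transposeℕ n i v)

    toℕ-κ-permutation : ∀ u → toℕ (κ-permutation ⟨$⟩ˡ u) ≡ τ (toℕ u)
    toℕ-κ-permutation u
      rewrite toℕ-transpose (fromℕ< (s≤s (<⇒≤ P<n))) Fin.zero (PC.transpose (fromℕ n) (fromℕ< (s≤s i≤n)) u)
            | toℕ-transpose (fromℕ n) (fromℕ< (s≤s i≤n)) u
            | toℕ-fromℕ< (s≤s (<⇒≤ P<n)) | toℕ-fromℕ< (s≤s i≤n) | toℕ-fromℕ n = refl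

    coeff : ℕ → ℕ
    coeff v = κ-coeff q′ n i (τ v)

    act-κ-permutation : ∀ u → act κ-permutation (κ (suc q′) n i) u ≡ coeff (toℕ u)
    act-κ-permutation u = trans (κ≡κ-coeff q′ n i _) (cong (κ-coeff q′ n i) (toℕ-κ-permutation u))

    τ-P : τ P ≡ 0
    τ-P = trans (cong (transposeℕ P 0) (transposeℕ-≢ (<⇒≢ P<n) (<⇒≢ P<i))) (transposeℕ-ˡ P 0)

    τ-i : τ i ≡ n
    τ-i = trans (cong (transposeℕ P 0) (transposeℕ-ʳ n i)) (transposeℕ-≢ (>⇒≢ P<n) (>⇒≢ (<-trans z<s 1<n)))

    τ-below : ∀ {v} → v < i → v ≢ P → 0 < τ v × τ v < i
    τ-below {v} v<i v≢P rewrite transposeℕ-≢ {n} {i} (<⇒≢ (<-≤-trans v<i i≤n)) (<⇒≢ v<i) with v ≟ 0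
    ... | yes refl = subst (λ w → 0 < w × w < i) (sym (transposeℕ-ʳ P 0)) (n≢0⇒n>0 (≢-sym v≢P) , P<i)
    ... | no v≢0   = subst (λ w → 0 < w × w < i) (sym (transposeℕ-≢ v≢P v≢0)) (n≢0⇒n>0 v≢0 , v<i)

    τ-above : ∀ {v} → i < v → v ≤ n → i ≤ τ v × τ v < n
    τ-above {v} i<v v≤n = by-cases (v ≟ n)
      where
      by-cases : Dec (v ≡ n) → i ≤ τ v × τ v < n
      by-cases (yes refl) = subst (λ w → i ≤ w × w < v) (sym (trans (cong (transposeℕ P 0) (transposeℕ-ˡ v i))
                              (transposeℕ-≢ (>⇒≢ P<i) (>⇒≢ 1≤i)))) (≤-refl , i<v)
      by-cases (no v≢n)   = subst (λ w → i ≤ w × w < n) (sym (trans (cong (transposeℕ P 0) (transposeℕ-≢ v≢n (>⇒≢ i<v)))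
                              (transposeℕ-≢ (>⇒≢ (<-trans P<i i<v)) (>⇒≢ (<-≤-trans z<s i<v)))))
                              (<⇒≤ i<v , ≤∧≢⇒< v≤n v≢n)

    coeff-P : coeff P ≡ suc (suc q′)
    coeff-P = trans (cong (κ-coeff q′ n i) τ-P) (κ-coeff-0 q′ 1≤i i≤n 1<n)

    coeff-below : ∀ {v} → v < i → v ≢ P → coeff v ≡ suc q′
    coeff-below v<i v≢P with τ-below v<i v≢P
    ... | 0<τv , τv<i = κ-coeff-low q′ 1≤i i≤n 1<n 0<τv τv<i

    coeff-i : coeff i ≡ 0
    coeff-i = trans (cong (κ-coeff q′ n i) τ-i) (κ-coeff-n q′ 1≤i i≤n 1<n)

    coeff-above : ∀ {v} → i < v → v ≤ n → coeff v ≡ 1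
    coeff-above i<v v≤n with τ-above i<v v≤n
    ... | i≤τv , τv<n = κ-coeff-high q′ 1≤i i≤n 1<n i≤τv τv<n

    expansion-coeff-block : ∀ {m} → i < P + m → P + m ≤ suc n →
      expansion (suc q′) m (λ t → coeff (P + t)) ≡ repunit (suc q′) m
    expansion-coeff-block {m} i<P+m P+m≤1+n = expansion-borrow (suc q′) r m (λ t → coeff (P + t))
      (+-cancelˡ-< P r m (subst (_< P + m) (sym P+r≡i) i<P+m))
      (trans (cong coeff (+-identityʳ P)) coeff-P)
      (λ t 0<t t<r → coeff-below (subst (P + t <_) P+r≡i (+-monoʳ-< P t<r)) (>⇒≢ (m<m+n P 0<t)))
      (trans (cong coeff P+r≡i) coeff-i)
      (λ t r<t t<m → coeff-above (subst (_< P + t) P+r≡i (+-monoʳ-< P r<t)) (s≤s⁻¹ (<-≤-trans (+-monoʳ-< P t<m) P+m≤1+n)))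
      where
      r = i ∸ P
      P+r≡i : P + r ≡ i
      P+r≡i = m+[n∸m]≡n (<⇒≤ P<i)

module Monomials {c ℓ : Level} (F : CommutativeRing c ℓ) where
  open import Data.Nat as ℕ using (ℕ; zero; suc)
  import Data.Nat.Properties as ℕ
  open import Data.Nat.Solver using (module +-*-Solver)
  open import Data.List using (List; []; _∷_; _++_; length; zipWith; tabulate; applyUpTo)
  open import Data.Fin as Fin using (Fin; toℕ)
  open import Function using (_∘_)
  open import Relation.Binary.PropositionalEquality as ≡ using (_≡_)
  open CommutativeRing F
  open RingOps F
  import Algebra.Properties.Semiring.Exp semiring as Exp
  open import Relation.Binary.Reasoning.Setoid setoid
  open Expansion

  pow≡^ : ∀ x m → pow x m ≡ x Exp.^ m
  pow≡^ x zero    = ≡.refl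
  pow≡^ x (suc m) = ≡.cong (x *_) (pow≡^ x m)

  pow-+ : ∀ x a b → pow x (a ℕ.+ b) ≈ pow x a * pow x b
  pow-+ x a b rewrite pow≡^ x (a ℕ.+ b) | pow≡^ x a | pow≡^ x b = Exp.^-homo-* x a b

  pow-* : ∀ x a b → pow (pow x a) b ≈ pow x (a ℕ.* b)
  pow-* x a b rewrite pow≡^ (pow x a) b | pow≡^ x a | pow≡^ x (a ℕ.* b) = Exp.^-assocʳ x a b

  monomial : List Carrier → (ℕ → ℕ) → Carrier
  monomial []       e = 1#
  monomial (x ∷ xs) e = pow x (e 0) * monomial xs (e ∘ suc)

  monomial-cong : ∀ xs {e e′} → (∀ t → e t ≡ e′ t) → monomial xs e ≡ monomial xs e′
  monomial-cong []       e≡e′ = ≡.refl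
  monomial-cong (x ∷ xs) e≡e′ = ≡.cong₂ (λ a m → pow x a * m) (e≡e′ 0) (monomial-cong xs (e≡e′ ∘ suc))

  monomial-++ : ∀ xs ys e → monomial (xs ++ ys) e ≈ monomial xs e * monomial ys (λ t → e (length xs ℕ.+ t))
  monomial-++ []       ys e = sym (*-identityˡ _)
  monomial-++ (x ∷ xs) ys e = trans (*-congˡ (monomial-++ xs ys (e ∘ suc))) (sym (*-assoc _ _ _))

  monomial-ones : ∀ xs → monomial xs (λ _ → 1) ≈ prod xs
  monomial-ones []       = refl
  monomial-ones (x ∷ xs) = *-cong (*-identityʳ x) (monomial-ones xs)

  monomial-zeros : ∀ xs → monomial xs (λ _ → 0) ≈ 1#
  monomial-zeros []       = refl
  monomial-zeros (x ∷ xs) = trans (*-identityˡ _) (monomial-zeros xs)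

  prod-zipWith-pow : ∀ {m} xs (μ : Fin m → ℕ) e → length xs ≡ m → (∀ u → μ u ≡ e (toℕ u)) →
    prod (zipWith pow xs (tabulate μ)) ≈ monomial xs e
  prod-zipWith-pow {zero}  []       μ e _       _    = refl
  prod-zipWith-pow {suc m} (x ∷ xs) μ e |xs|≡m μ≡e =
    *-cong (reflexive (≡.cong (pow x) (μ≡e Fin.zero)))
           (prod-zipWith-pow xs (μ ∘ Fin.suc) (e ∘ suc) (ℕ.suc-injective |xs|≡m) (μ≡e ∘ Fin.suc))

  monomial-powers : ∀ q y m (k : ℕ → ℕ) e → (∀ t → k (suc t) ≡ q ℕ.* k t) →
    monomial (applyUpTo (λ t → pow y (k t)) m) e ≈ pow y (k 0 ℕ.* expansion q m e)
  monomial-powers q y zero    k e _ = reflexive (≡.cong (pow y) (≡.sym (ℕ.*-zeroʳ (k 0))))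
  monomial-powers q y (suc m) k e k-geometric = begin
    pow (pow y (k 0)) (e 0) * monomial (applyUpTo (λ t → pow y (k (suc t))) m) (e ∘ suc)
      ≈⟨ *-cong (pow-* y (k 0) (e 0)) (monomial-powers q y m (k ∘ suc) (e ∘ suc) (k-geometric ∘ suc)) ⟩
    pow y (k 0 ℕ.* e 0) * pow y (k 1 ℕ.* E)
      ≈⟨ pow-+ y (k 0 ℕ.* e 0) (k 1 ℕ.* E) ⟨
    pow y (k 0 ℕ.* e 0 ℕ.+ k 1 ℕ.* E)
      ≡⟨ ≡.cong (λ k₁ → pow y (k 0 ℕ.* e 0 ℕ.+ k₁ ℕ.* E)) (k-geometric 0) ⟩
    pow y (k 0 ℕ.* e 0 ℕ.+ q ℕ.* k 0 ℕ.* E)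
      ≡⟨ ≡.cong (pow y) (solve 4 (λ k a q E → k :* a :+ q :* k :* E := k :* (a :+ q :* E)) ≡.refl (k 0) (e 0) q E) ⟩
    pow y (k 0 ℕ.* expansion q (suc m) e) ∎
    where
    open +-*-Solver
    E = expansion q m (e ∘ suc)

module Blocks {c ℓ : Level} (F : CommutativeRing c ℓ) (q′ : ℕ) where
  open import Level using (_⊔_)
  open import Data.Nat as ℕ using (ℕ; suc)
  import Data.Nat.Properties as ℕ
  open import Data.Nat.ListAction using (sum)
  open import Data.List using (List; []; _∷_; _++_; map; upTo; applyUpTo; length; concatMap)
  open import Data.List.Properties using (length-map; length-upTo; map-upTo; length-++)
  open import Data.List.Relation.Unary.All using (All; []; _∷_)
  open import Data.Product using (Σ; _×_; _,_; proj₂)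
  open import Relation.Binary.PropositionalEquality as ≡ using (_≡_)
  open CommutativeRing F
  open RingOps F
  open Monomials F
  open Expansion
  open import Relation.Binary.Reasoning.Setoid setoid

  private
    q : ℕ
    q = suc q′

  block : Carrier × ℕ → List Carrier
  block (y , m) = map (λ t → pow y (q ℕ.^ t)) (upTo m)

  length-block : ∀ b → length (block b) ≡ proj₂ b
  length-block (y , m) = ≡.trans (length-map _ (upTo m)) (length-upTo m)

  monomial-block : ∀ y m e → monomial (block (y , m)) e ≈ pow y (expansion q m e)
  monomial-block y m e = begin
    monomial (map (λ t → pow y (q ℕ.^ t)) (upTo m)) e ≡⟨ ≡.cong (λ xs → monomial xs e) (map-upTo _ m) ⟩
    monomial (applyUpTo (λ t → pow y (q ℕ.^ t)) m) e   ≈⟨ monomial-powers q y m (q ℕ.^_) e (λ _ → ≡.refl) ⟩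
    pow y (1 ℕ.* expansion q m e)                      ≡⟨ ≡.cong (pow y) (ℕ.*-identityˡ (expansion q m e)) ⟩
    pow y (expansion q m e)                            ∎

  size : List (Carrier × ℕ) → ℕ
  size bs = sum (map proj₂ bs)

  length-concatMap-block : ∀ bs → length (concatMap block bs) ≡ size bs
  length-concatMap-block []              = ≡.refl
  length-concatMap-block ((y , m) ∷ bs) =
    ≡.trans (length-++ (block (y , m))) (≡.cong₂ ℕ._+_ (length-block (y , m)) (length-concatMap-block bs))

  monomial-blocks-∷ : ∀ y m bs o e →
    monomial (concatMap block ((y , m) ∷ bs)) (λ t → e (o ℕ.+ t)) ≈
    pow y (expansion q m (λ t → e (o ℕ.+ t))) * monomial (concatMap block bs) (λ t → e (o ℕ.+ m ℕ.+ t))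
  monomial-blocks-∷ y m bs o e = begin
    monomial (block (y , m) ++ concatMap block bs) (λ t → e (o ℕ.+ t))
      ≈⟨ monomial-++ (block (y , m)) _ _ ⟩
    monomial (block (y , m)) (λ t → e (o ℕ.+ t)) * monomial (concatMap block bs) (λ t → e (o ℕ.+ (length (block (y , m)) ℕ.+ t)))
      ≈⟨ *-cong (monomial-block y m _) (reflexive (monomial-cong (concatMap block bs) λ t →
           ≡.cong e (≡.trans (≡.cong (λ l → o ℕ.+ (l ℕ.+ t)) (length-block (y , m))) (≡.sym (ℕ.+-assoc o m t))))) ⟩
    pow y (expansion q m (λ t → e (o ℕ.+ t))) * monomial (concatMap block bs) (λ t → e (o ℕ.+ m ℕ.+ t)) ∎

  -- (y , m) stands for y ∈ 𝔽_{q^m}ˣ, with 𝔽_{q^m} the fixed field of y ↦ y ^ q ^ m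
  In𝔽ˣ : Carrier × ℕ → Set (c ⊔ ℓ)
  In𝔽ˣ (y , m) = Σ Carrier (λ z → y * z ≈ 1#) × pow y (q ℕ.^ m) ≈ y

  pow-q′*repunit≈1 : ∀ {y m} → In𝔽ˣ (y , m) → pow y (q′ ℕ.* repunit q m) ≈ 1#
  pow-q′*repunit≈1 {y} {m} ((z , yz≈1) , y-fixed) = begin
    a             ≈⟨ *-identityʳ a ⟨
    a * 1#        ≈⟨ *-congˡ yz≈1 ⟨
    a * (y * z)   ≈⟨ *-assoc a y z ⟨
    a * y * z     ≈⟨ *-congʳ ay≈y ⟩
    y * z         ≈⟨ yz≈1 ⟩
    1#            ∎
    where
    a = pow y (q′ ℕ.* repunit q m)
    ay≈y : a * y ≈ y
    ay≈y = begin
      a * y                             ≈⟨ *-congˡ (*-identityʳ y) ⟨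
      a * pow y 1                       ≈⟨ pow-+ y (q′ ℕ.* repunit q m) 1 ⟨
      pow y (q′ ℕ.* repunit q m ℕ.+ 1)  ≡⟨ ≡.cong (pow y) (pred*repunit+1≡^ q′ m) ⟩
      pow y (q ℕ.^ m)                   ≈⟨ y-fixed ⟩
      y                                 ∎

  pow-expansion-shift : ∀ {y m e e′} → In𝔽ˣ (y , m) → (∀ t → t ℕ.< m → e t ≡ e′ t ℕ.+ q′) →
    pow y (expansion q m e) ≈ pow y (expansion q m e′)
  pow-expansion-shift {y} {m} {e} {e′} y∈𝔽ˣ e≡e′+q′ = begin
    pow y (expansion q m e)                              ≡⟨ ≡.cong (pow y) exponent ⟩
    pow y (expansion q m e′ ℕ.+ q′ ℕ.* repunit q m)      ≈⟨ pow-+ y (expansion q m e′) (q′ ℕ.* repunit q m) ⟩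
    pow y (expansion q m e′) * pow y (q′ ℕ.* repunit q m) ≈⟨ *-congˡ (pow-q′*repunit≈1 {m = m} y∈𝔽ˣ) ⟩
    pow y (expansion q m e′) * 1#                        ≈⟨ *-identityʳ _ ⟩
    pow y (expansion q m e′)                             ∎
    where
    exponent : expansion q m e ≡ expansion q m e′ ℕ.+ q′ ℕ.* repunit q m
    exponent = ≡.trans (expansion-cong q m e≡e′+q′)
                 (≡.trans (expansion-+ q m e′ (λ _ → q′)) (≡.cong (expansion q m e′ ℕ.+_) (expansion-const q m q′)))

  data BlockwiseEqual (e e′ : ℕ → ℕ) : ℕ → List (Carrier × ℕ) → Set (c ⊔ ℓ) where
    []  : ∀ {o} → BlockwiseEqual e e′ o []
    _∷_ : ∀ {o y m bs} →
          pow y (expansion q m (λ t → e (o ℕ.+ t))) ≈ pow y (expansion q m (λ t → e′ (o ℕ.+ t))) →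
          BlockwiseEqual e e′ (o ℕ.+ m) bs → BlockwiseEqual e e′ o ((y , m) ∷ bs)

  blockwise-++ : ∀ {e e′ o xs ys} → BlockwiseEqual e e′ o xs → BlockwiseEqual e e′ (o ℕ.+ size xs) ys →
    BlockwiseEqual e e′ o (xs ++ ys)
  blockwise-++ {e} {e′} {o} {ys = ys} [] eq-ys = ≡.subst (λ o′ → BlockwiseEqual e e′ o′ ys) (ℕ.+-identityʳ o) eq-ys
  blockwise-++ {e} {e′} {o} {ys = ys} (_∷_ {m = m} {bs = xs} eq eq-xs) eq-ys =
    eq ∷ blockwise-++ eq-xs (≡.subst (λ o′ → BlockwiseEqual e e′ o′ ys) (≡.sym (ℕ.+-assoc o m (size xs))) eq-ys)

  monomial-blockwise : ∀ {e e′ o bs} → BlockwiseEqual e e′ o bs →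
    monomial (concatMap block bs) (λ t → e (o ℕ.+ t)) ≈ monomial (concatMap block bs) (λ t → e′ (o ℕ.+ t))
  monomial-blockwise []         = refl
  monomial-blockwise {e} {e′} {o} {bs = (y , m) ∷ bs} (eq ∷ eqs) = begin
    monomial (concatMap block ((y , m) ∷ bs)) (λ t → e (o ℕ.+ t))
      ≈⟨ monomial-blocks-∷ y m bs o e ⟩
    pow y (expansion q m (λ t → e (o ℕ.+ t))) * monomial (concatMap block bs) (λ t → e (o ℕ.+ m ℕ.+ t))
      ≈⟨ *-cong eq (monomial-blockwise eqs) ⟩
    pow y (expansion q m (λ t → e′ (o ℕ.+ t))) * monomial (concatMap block bs) (λ t → e′ (o ℕ.+ m ℕ.+ t))
      ≈⟨ monomial-blocks-∷ y m bs o e′ ⟨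
    monomial (concatMap block ((y , m) ∷ bs)) (λ t → e′ (o ℕ.+ t)) ∎

  blockwise-pointwise : (_∼_ : ℕ → ℕ → Set) →
    (∀ {y m e e′} → In𝔽ˣ (y , m) → (∀ t → t ℕ.< m → e t ∼ e′ t) → pow y (expansion q m e) ≈ pow y (expansion q m e′)) →
    ∀ {e e′} o bs → All In𝔽ˣ bs → (∀ u → o ℕ.≤ u → u ℕ.< o ℕ.+ size bs → e u ∼ e′ u) → BlockwiseEqual e e′ o bs
  blockwise-pointwise _∼_ pow-∼ o []             []             _     = []
  blockwise-pointwise _∼_ pow-∼ o ((y , m) ∷ bs) (y∈𝔽ˣ ∷ bs∈𝔽ˣ) e∼e′ =
    pow-∼ y∈𝔽ˣ (λ t t<m → e∼e′ (o ℕ.+ t) (ℕ.m≤m+n o t) (ℕ.+-monoʳ-< o (ℕ.<-≤-trans t<m (ℕ.m≤m+n m (size bs)))))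
    ∷ blockwise-pointwise _∼_ pow-∼ (o ℕ.+ m) bs bs∈𝔽ˣ λ u o+m≤u u<o+m+s →
        e∼e′ u (ℕ.≤-trans (ℕ.m≤m+n o m) o+m≤u) (≡.subst (u ℕ.<_) (ℕ.+-assoc o m (size bs)) u<o+m+s)

  blockwise-shift : ∀ {e e′} o bs → All In𝔽ˣ bs → (∀ u → o ℕ.≤ u → u ℕ.< o ℕ.+ size bs → e u ≡ e′ u ℕ.+ q′) →
    BlockwiseEqual e e′ o bs
  blockwise-shift = blockwise-pointwise (λ a b → a ≡ b ℕ.+ q′) pow-expansion-shift

  blockwise-≡ : ∀ {e e′} o bs → All In𝔽ˣ bs → (∀ u → o ℕ.≤ u → u ℕ.< o ℕ.+ size bs → e u ≡ e′ u) →
    BlockwiseEqual e e′ o bs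
  blockwise-≡ = blockwise-pointwise _≡_ λ {y} {m} _ e≡e′ → reflexive (≡.cong (pow y) (expansion-cong q m e≡e′))

module DiagonalTorus {c ℓ : Level} (F : CommutativeRing c ℓ) (q′ n : ℕ) (π : List ℕ) where
  open import Data.Nat as ℕ using (ℕ; suc; s≤s⁻¹; _<?_)
  import Data.Nat.Properties as ℕ
  open import Data.Nat.ListAction using (sum)
  open import Data.Nat.ListAction.Properties using (sum-++)
  open import Data.List using (List; _∷_; _++_; map; length; concat; concatMap; tabulate; lookup)
  open import Data.List.Properties using (map-tabulate; tabulate-lookup; ∷-injectiveˡ; ∷-injectiveʳ)
  open import Data.List.Relation.Unary.All as All using (All)
  open import Data.List.Relation.Unary.All.Properties using (tabulate⁺; ++⁻ˡ; ++⁻ʳ)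
  open import Data.Fin using (Fin; toℕ)
  open import Data.Product using (_×_; _,_; proj₂)
  open import Function using (id)
  open import Relation.Binary.PropositionalEquality as ≡ using (_≡_; refl)
  open CommutativeRing F
  open RingOps F
  open TorusOps F (suc q′) π
  open Expansion
  open Lists
  open KappaCoefficients
  open Monomials F
  open Blocks F q′
  open import Relation.Binary.Reasoning.Setoid setoid

  blocksOf : (Fin (length π) → Carrier) → List (Carrier × ℕ)
  blocksOf y = tabulate (λ j → (y j , lookup π j))

  diagEntries≡ : ∀ y → diagEntries y ≡ concatMap block (blocksOf y)
  diagEntries≡ y = ≡.trans (≡.cong concat (map-tabulate id (λ j → block (y j , lookup π j))))
                           (≡.sym (≡.cong concat (map-tabulate (λ j → (y j , lookup π j)) block)))

  map-proj₂-blocksOf : ∀ y → map proj₂ (blocksOf y) ≡ π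
  map-proj₂-blocksOf y = ≡.trans (map-tabulate _ proj₂) (tabulate-lookup π)

  blocksOf-In𝔽ˣ : IsField F → ∀ {y} → InDπ y → All In𝔽ˣ (blocksOf y)
  blocksOf-In𝔽ˣ (_ , inverse) (y≢0 , y-fixed , _) = tabulate⁺ (λ j → inverse _ (y≢0 j) , y-fixed j)

  length-diagEntries : sum π ≡ suc n → ∀ y → length (diagEntries y) ≡ suc n
  length-diagEntries Σπ y =
    ≡.trans (≡.cong length (diagEntries≡ y))
      (≡.trans (length-concatMap-block (blocksOf y)) (≡.trans (≡.cong sum (map-proj₂-blocksOf y)) Σπ))

  trivial-if-blockwise : ∀ (μ : Weight n) e e′ → sum π ≡ suc n → (∀ u → μ u ≡ e (toℕ u)) →
    (∀ y → InDπ y → BlockwiseEqual e e′ 0 (blocksOf y)) → (∀ y → InDπ y → monomial (diagEntries y) e′ ≈ 1#) →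
    TrivialOnDπ μ
  trivial-if-blockwise μ e e′ Σπ μ≡e blockwise e′-trivial y y∈D = begin
    evalWeight μ (diagEntries y)                ≈⟨ prod-zipWith-pow (diagEntries y) μ e (length-diagEntries Σπ y) μ≡e ⟩
    monomial (diagEntries y) e                  ≡⟨ ≡.cong (λ xs → monomial xs e) (diagEntries≡ y) ⟩
    monomial (concatMap block (blocksOf y)) e   ≈⟨ monomial-blockwise (blockwise y y∈D) ⟩
    monomial (concatMap block (blocksOf y)) e′  ≡⟨ ≡.cong (λ xs → monomial xs e′) (diagEntries≡ y) ⟨
    monomial (diagEntries y) e′                 ≈⟨ e′-trivial y y∈D ⟩
    1#                                          ∎

  λ-trivial-at-boundary : IsField F → IsPartition (suc n) π → ∀ {i as bs} → π ≡ as ++ bs → sum as ≡ i →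
    TrivialOnDπ (λw (suc q′) n i)
  λ-trivial-at-boundary isField (_ , _ , Σπ) {i} {as} {bs} π≡ Σas≡i =
    trivial-if-blockwise _ coeff (λ _ → 0) Σπ (λ u → ≡.cong (q′ ℕ.*_) (ω≡𝟙 n i u)) blockwise
      (λ y _ → monomial-zeros (diagEntries y))
    where
    coeff : ℕ → ℕ
    coeff v = q′ ℕ.* 𝟙 (v <? i)

    blockwise : ∀ y → InDπ y → BlockwiseEqual coeff (λ _ → 0) 0 (blocksOf y)
    blockwise y y∈D with map-≡-++ proj₂ (blocksOf y) {as} {bs} (≡.trans (map-proj₂-blocksOf y) π≡)
    ... | ys , zs , blocks≡ , ys-sizes , _ =
      ≡.subst (BlockwiseEqual coeff (λ _ → 0) 0) (≡.sym blocks≡) (blockwise-++ before after)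
      where
      in𝔽ˣ : All In𝔽ˣ (ys ++ zs)
      in𝔽ˣ = ≡.subst (All In𝔽ˣ) blocks≡ (blocksOf-In𝔽ˣ isField y∈D)
      |ys|≡i : size ys ≡ i
      |ys|≡i = ≡.trans (≡.cong sum ys-sizes) Σas≡i
      before : BlockwiseEqual coeff (λ _ → 0) 0 ys
      before = blockwise-shift 0 ys (++⁻ˡ ys in𝔽ˣ) λ u _ u<|ys| →
        ≡.trans (≡.cong (q′ ℕ.*_) (𝟙-yes (u <? i) (≡.subst (u ℕ.<_) |ys|≡i u<|ys|))) (ℕ.*-identityʳ q′)
      after : BlockwiseEqual coeff (λ _ → 0) (size ys) zs
      after = blockwise-≡ (size ys) zs (++⁻ʳ ys in𝔽ˣ) λ u |ys|≤u _ →
        ≡.trans (≡.cong (q′ ℕ.*_) (𝟙-no (u <? i) (ℕ.≤⇒≯ (≡.subst (ℕ._≤ u) |ys|≡i |ys|≤u)))) (ℕ.*-zeroʳ q′)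

  κ-trivial-inside-block : IsField F → IsPartition (suc n) π → ∀ {i} (1≤i : 1 ℕ.≤ i) (i≤n : i ℕ.≤ n) (1<n : 1 ℕ.< n) →
    ∀ {as m bs} → π ≡ as ++ m ∷ bs → (P<i : sum as ℕ.< i) → i ℕ.< sum as ℕ.+ m →
    TrivialOnDπ (act (PermutedKappa.κ-permutation q′ 1≤i i≤n 1<n P<i) (κ (suc q′) n i))
  κ-trivial-inside-block isField (_ , _ , Σπ) {i} 1≤i i≤n 1<n {as} {m} {bs} π≡ P<i i<P+m =
    trivial-if-blockwise _ coeff (λ _ → 1) Σπ act-κ-permutation blockwise
      (λ y y∈D → trans (monomial-ones (diagEntries y)) (proj₂ (proj₂ y∈D)))
    where
    open PermutedKappa q′ 1≤i i≤n 1<n P<i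

    P+m+Σbs≡1+n : sum as ℕ.+ m ℕ.+ sum bs ≡ suc n
    P+m+Σbs≡1+n = ≡.trans (ℕ.+-assoc (sum as) m (sum bs))
                    (≡.trans (≡.sym (sum-++ as (m ∷ bs))) (≡.trans (≡.cong sum (≡.sym π≡)) Σπ))

    blockwise : ∀ y → InDπ y → BlockwiseEqual coeff (λ _ → 1) 0 (blocksOf y)
    blockwise y y∈D with map-≡-++ proj₂ (blocksOf y) {as} {m ∷ bs} (≡.trans (map-proj₂-blocksOf y) π≡)
    ... | ys , (yb , m′) ∷ zs , blocks≡ , ys-sizes , zs-sizes with ∷-injectiveˡ zs-sizes
    ... | refl =
      ≡.subst (BlockwiseEqual coeff (λ _ → 1) 0) (≡.sym blocks≡) (blockwise-++ before (containing ∷ after))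
      where
      in𝔽ˣ : All In𝔽ˣ (ys ++ (yb , m) ∷ zs)
      in𝔽ˣ = ≡.subst (All In𝔽ˣ) blocks≡ (blocksOf-In𝔽ˣ isField y∈D)
      |ys|≡P : size ys ≡ sum as
      |ys|≡P = ≡.cong sum ys-sizes
      end≡1+n : size ys ℕ.+ m ℕ.+ size zs ≡ suc n
      end≡1+n = ≡.trans (≡.cong₂ (λ p s → p ℕ.+ m ℕ.+ s) |ys|≡P (≡.cong sum (∷-injectiveʳ zs-sizes))) P+m+Σbs≡1+n

      before : BlockwiseEqual coeff (λ _ → 1) 0 ys
      before = blockwise-shift 0 ys (++⁻ˡ ys in𝔽ˣ) λ u _ u<|ys| →
        let u<P = ≡.subst (u ℕ.<_) |ys|≡P u<|ys| in coeff-below (ℕ.<-trans u<P P<i) (ℕ.<⇒≢ u<P)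

      containing : pow yb (expansion (suc q′) m (λ t → coeff (size ys ℕ.+ t))) ≈ pow yb (repunit (suc q′) m)
      containing = reflexive (≡.cong (pow yb) (≡.trans (≡.cong (λ o → expansion (suc q′) m (λ t → coeff (o ℕ.+ t))) |ys|≡P)
        (expansion-coeff-block i<P+m (≡.subst (sum as ℕ.+ m ℕ.≤_) P+m+Σbs≡1+n (ℕ.m≤m+n _ (sum bs))))))

      after : BlockwiseEqual coeff (λ _ → 1) (size ys ℕ.+ m) zs
      after = blockwise-≡ (size ys ℕ.+ m) zs (All.tail (++⁻ʳ ys in𝔽ˣ)) λ u |ys|+m≤u u<end →
        coeff-above (ℕ.<-≤-trans i<P+m (≡.subst (λ p → p ℕ.+ m ℕ.≤ u) |ys|≡P |ys|+m≤u))
                    (s≤s⁻¹ (≡.subst (u ℕ.<_) end≡1+n u<end))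

open import Data.Nat using (zero; z≤n; s≤s; _≟_; ≢-nonZero⁻¹)
open import Data.Nat.Properties using (≤∧≢⇒<; m^n≡0⇒m≡0)
open import Data.Nat.Primality using (prime⇒nonZero)
open import Data.Nat.ListAction using (sum)
open import Data.Product using (_,_)
open import Data.Sum using (inj₁; inj₂)
open import Data.Fin.Permutation using (id)
open import Relation.Nullary using (yes; no; contradiction)
open import Relation.Binary.PropositionalEquality using (_≢_; refl; trans; subst; sym)
open Lists using (split-containing)
open KappaCoefficients.PermutedKappa using (κ-permutation)
open DiagonalTorus using (λ-trivial-at-boundary; κ-trivial-inside-block)

prime-power≢0 : ∀ {p q} → IsPrimePowerOf p q → q ≢ 0
prime-power≢0 {p} (p-prime , e , _ , q≡p^e) q≡0 =
  ≢-nonZero⁻¹ p {{prime⇒nonZero p-prime}} (m^n≡0⇒m≡0 p e (trans (sym q≡p^e) q≡0))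

lemma6p7 : {c ℓ : Level} (p q : ℕ) → IsPrimePowerOf p q → (n : ℕ) → 1 < n →
  (F : CommutativeRing c ℓ) → IsField F → IsAlgClosed F → HasChar F p →
  (π : List ℕ) → IsPartition (suc n) π → (i : ℕ) → 1 ≤ i → i ≤ n →
  Σ (Permutation′ (suc n)) (λ σ →
    TorusOps.TrivialOnDπ F q π (act σ (κ q n i)) ⊎ TorusOps.TrivialOnDπ F q π (act σ (λw q n i)))
lemma6p7 p zero     q-prime-power _ _ _ _ _ _ _ _ _ _ _ = contradiction refl (prime-power≢0 q-prime-power)
lemma6p7 p (suc q′) _ n 1<n F isField _ _ π π-partition@(_ , _ , Σπ) i 1≤i i≤n
  with split-containing π 0 i z≤n (subst (i <_) (sym Σπ) (s≤s i≤n))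
... | as , m , bs , π≡ , Σas≤i , i<Σas+m with sum as ≟ i
...   | yes Σas≡i = id , inj₂ (λ-trivial-at-boundary F q′ n π isField π-partition {as = as} π≡ Σas≡i)
...   | no Σas≢i  = κ-permutation q′ 1≤i i≤n 1<n P<i ,
                    inj₁ (κ-trivial-inside-block F q′ n π isField π-partition 1≤i i≤n 1<n π≡ P<i i<Σas+m)
  where P<i = ≤∧≢⇒< Σas≤i Σas≢i
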